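{- For every $n\geqslant1$, the triples of set-valued statistics $\left({\rm bAsc},{\rm Des},{\rm Suc}\right)$ and $\left(\widehat{{\rm Exc}},{\rm Drop},\widehat{{\rm Fix}}\right)$ are equidistributed over $\mathfrak{S}_n$, i.e. for all $X,Y,Z\subseteq[n]$, $$\#\{\pi\in\mathfrak{S}_n:({\rm bAsc}(\pi),{\rm Des}(\pi),{\rm Suc}(\pi))=(X,Y,Z)\}=\#\{\pi\in\mathfrak{S}_n:(\widehat{{\rm Exc}}(\pi),{\rm Drop}(\pi),\widehat{{\rm Fix}}(\pi))=(X,Y,Z)\}.$$ Hence $$\sum_{\pi\in\mathfrak{S}_n}x^{{\rm basc}(\pi)}y^{{\rm des}(\pi)}s^{{\rm suc}(\pi)}=\sum_{\pi\in\mathfrak{S}_n}x^{\widehat{{\rm exc}}(\pi)}y^{{\rm drop}(\pi)}s^{\widehat{{\rm fix}}(\pi)},$$ and $\widehat{{\rm exc}}+\widehat{{\rm fix}}$ is equidistributed with ${\rm asc}$ over $\mathfrak{S}_n$.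
   Context: For $\pi\in\mathfrak{S}_n$: ${\rm bAsc}(\pi)=\{\pi(i+1):\pi(i+1)\geqslant\pi(i)+2,\ i\in[n-1]\}$, ${\rm Des}(\pi)=\{\pi(i+1):\pi(i)>\pi(i+1),\ i\in[n-1]\}$, ${\rm Suc}(\pi)=\{\pi(i+1):\pi(i+1)=\pi(i)+1,\ i\in[n-1]\}$, ${\rm Drop}(\pi)=\{\pi(i):\pi(i)<i,\ i\in\{2,\ldots,n\}\}$, $\widehat{{\rm Exc}}(\pi)=\{\pi(i):\pi(i)>i,\ i\in\{2,\ldots,n\}\}$, $\widehat{{\rm Fix}}(\pi)=\{\pi(i):\pi(i)=i,\ i\in\{2,\ldots,n\}\}$. The corresponding lower-case statistics are the cardinalities: ${\rm basc}=\#{\rm bAsc}$, ${\rm des}=\#{\rm Des}$, ${\rm suc}=\#{\rm Suc}$, ${\rm drop}=\#{\rm Drop}$, $\widehat{{\rm exc}}=\#\widehat{{\rm Exc}}$, $\widehat{{\rm fix}}=\#\widehat{{\rm Fix}}$. ${\rm asc}(\pi)=\#\{i\in[n-1]:\pi(i)<\pi(i+1)\}$. -}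

module Defs where

open import Data.Nat using (ℕ; zero; suc; _+_; _≤_; _<_; _≥_)
import Data.Nat as ℕ
import Data.Nat.Properties as ℕP
open import Data.Fin using (Fin; toℕ; inject₁)
open import Data.Fin.Properties using (any?; all?)
import Data.Fin.Properties as FinP
open import Data.Fin.Subset using (Subset; ∣_∣)
open import Data.Vec using (Vec; []; _∷_; lookup; tabulate)
import Data.Vec.Properties as VecP
open import Data.List using (List; [_]; concatMap; map; filter; length; allFin)
open import Data.Bool using (Bool)
import Data.Bool.Properties as BoolP
open import Data.Product using (_×_; _,_)
open import Data.Product.Properties using (≡-dec)
open import Relation.Nullary using (Dec; does)
open import Relation.Nullary.Decidable using (_×-dec_; ¬?)
open import Relation.Binary.PropositionalEquality using (_≡_; _≢_)

-- Conventions: [n] = {1,…,n} is modelled by Fin n, value k : Fin n standing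
-- for k+1; a permutation π ∈ 𝔖_n is its one-line word (π(1),…,π(n)),
-- a vector of length n over Fin n with pairwise distinct entries.
-- Position i (1-based) corresponds to index i-1 : Fin n.

words : (n k : ℕ) → List (Vec (Fin n) k)
words n zero    = [ [] ]
words n (suc k) = concatMap (λ x → map (x ∷_) (words n k)) (allFin n)

IsPerm : ∀ {n} → Vec (Fin n) n → Set
IsPerm {n} w = ∀ (i j : Fin n) → lookup w i ≡ lookup w j → i ≡ j

isPerm? : ∀ {n} (w : Vec (Fin n) n) → Dec (IsPerm w)
isPerm? w = all? λ i → all? λ j → decImp (lookup w i FinP.≟ lookup w j) (i FinP.≟ j)
  where
  open import Relation.Nullary.Decidable using (_→-dec_)
  decImp = _→-dec_

𝔖 : (n : ℕ) → List (Vec (Fin n) n)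
𝔖 n = filter isPerm? (words n n)

count : ∀ n {P : Vec (Fin n) n → Set} → (∀ w → Dec (P w)) → ℕ
count n P? = length (filter P? (𝔖 n))

module _ {m : ℕ} (π : Vec (Fin (suc m)) (suc m)) where
  -- n = suc m ; consecutive pairs (π(i), π(i+1)), i ∈ [n-1], are
  -- (lookup π (inject₁ i) , lookup π (suc i)) for i : Fin m
  private
    p : Fin m → Fin (suc m)
    p i = lookup π (inject₁ i)
    q : Fin m → Fin (suc m)
    q i = lookup π (Fin.suc i)

  bAsc : Subset (suc m)
  bAsc = tabulate λ v → does (any? λ i → (q i FinP.≟ v) ×-dec (toℕ (p i) + 2 ℕ.≤? toℕ (q i)))

  Des : Subset (suc m)
  Des = tabulate λ v → does (any? λ i → (q i FinP.≟ v) ×-dec (toℕ (q i) ℕ.<? toℕ (p i)))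

  Suc : Subset (suc m)
  Suc = tabulate λ v → does (any? λ i → (q i FinP.≟ v) ×-dec (toℕ (q i) ℕ.≟ suc (toℕ (p i))))

  -- Drop(π) = {π(i) : π(i) < i, i ∈ {2,…,n}}  (positions i ≥ 2 ↔ indices j ≥ 1)
  Drop : Subset (suc m)
  Drop = tabulate λ v → does (any? λ j →
    (1 ℕ.≤? toℕ j) ×-dec ((lookup π j FinP.≟ v) ×-dec (toℕ (lookup π j) ℕ.<? toℕ j)))

  Exc^ : Subset (suc m)
  Exc^ = tabulate λ v → does (any? λ j →
    (1 ℕ.≤? toℕ j) ×-dec ((lookup π j FinP.≟ v) ×-dec (toℕ j ℕ.<? toℕ (lookup π j))))

  Fix^ : Subset (suc m)
  Fix^ = tabulate λ v → does (any? λ j →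
    (1 ℕ.≤? toℕ j) ×-dec ((lookup π j FinP.≟ v) ×-dec (lookup π j FinP.≟ j)))

  basc des suc' drop exc^ fix^ : ℕ
  basc = ∣ bAsc ∣
  des  = ∣ Des ∣
  suc' = ∣ Suc ∣
  drop = ∣ Drop ∣
  exc^ = ∣ Exc^ ∣
  fix^ = ∣ Fix^ ∣

  asc : ℕ
  asc = ∣ tabulate (λ i → does (toℕ (p i) ℕ.<? toℕ (q i))) ∣

_≟S_ : ∀ {n} (X Y : Subset n) → Dec (X ≡ Y)
_≟S_ = VecP.≡-dec BoolP._≟_

_≟T_ : ∀ {n} (A B : Subset n × Subset n × Subset n) → Dec (A ≡ B)
_≟T_ = ≡-dec _≟S_ (≡-dec _≟S_ _≟S_)

{-# OPTIONS --safe #-}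
-- Cut π after its largest letter and before every later left-to-right minimum, and read the
-- pieces as the cycles of a permutation σ.  Inside a piece σ (π i) = π (i + 1), so the big ascents
-- and the successions of π are exactly the values σ x ≥ x + 2 and σ x = x + 1, while a cut is a
-- descent of π that closes a cycle with a value σ x ≤ x.  The word Φ π = σ n, σ 1, …, σ (n - 1)
-- turns these into excedance, fixed-point and drop values at positions ≥ 2, so
-- (bAsc, Des, Suc) π = (Exc^, Drop, Fix^) (Φ π).  Φ is injective, hence a bijection of 𝔖 n:
-- π 1 = σ n, and π (i + 1) = σ (π i) unless a cycle has just been closed, in which case π (i + 1)
-- is the largest minimum among the cycles not yet written.  Finally asc = basc + suc, since an
-- ascent is either a big ascent or a succession.

module Submission where

open import Defs
open import Data.Nat using (ℕ; zero; suc; _+_; _∸_; _≤_; _<_; _≟_; _<?_; _≤?_; z≤n; s≤s; z<s)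
import Data.Nat as ℕ
open import Data.Nat.Properties
open import Data.Nat.DivMod using (_mod_; m≤n⇒m%n≡m)
open import Data.Bool using (Bool; true; false; _∧_; _∨_; if_then_else_)
open import Data.Bool.Properties using (∧-identityʳ; ∧-zeroʳ)
open import Data.Fin using (Fin; toℕ; fromℕ<; inject₁; punchOut)
open import Data.Fin.Properties
  using (toℕ-injective; toℕ<n; toℕ≤pred[n]; toℕ-fromℕ<; toℕ-inject₁; any?; injective⇒≤; punchOut-injective)
import Data.Fin.Properties as FinP
open import Data.Fin.Subset using (Subset; ∣_∣)
open import Data.Vec using (Vec; []; _∷_; lookup; tabulate)
open import Data.Vec.Properties using (∷-injective; lookup∘tabulate; tabulate∘lookup; tabulate-cong)
open import Data.List using (List; []; _∷_; _++_; map; filter; length; allFin; cartesianProductWith; concatMap)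
open import Data.List.Properties using (length-++)
open import Data.List.Membership.Propositional using (_∈_)
open import Data.List.Membership.Propositional.Properties
  using (∈-++⁺ˡ; ∈-++⁺ʳ; ∈-++⁻; ∈-filter⁺; ∈-filter⁻; ∈-allFin; ∈-∃++; ∈-cartesianProductWith⁺)
open import Data.List.Relation.Unary.Any using (here; there)
open import Data.List.Relation.Unary.All as All using ([])
open import Data.List.Relation.Unary.AllPairs using ([]; _∷_)
open import Data.List.Relation.Unary.Unique.Propositional using (Unique)
open import Data.List.Relation.Unary.Unique.Propositional.Properties
  using (filter⁺; cartesianProductWith⁺; allFin⁺)
open import Data.Product using (_×_; _,_; proj₁; proj₂; ∃-syntax)
open import Data.Sum using (_⊎_; inj₁; inj₂)
open import Data.Unit using (⊤; tt)
open import Data.Empty using (⊥; ⊥-elim)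
open import Function using (_∘_; const; _⇔_; mk⇔; Injective; Equivalence)
open import Function.Construct.Composition using (_⇔-∘_)
open import Function.Construct.Symmetry using (⇔-sym)
open import Function.Construct.Identity using (⇔-id)
open import Relation.Nullary using (Dec; yes; no; does; ¬_)
open import Relation.Nullary.Negation using (contradiction)
open import Relation.Nullary.Decidable using (_×-dec_; _⊎-dec_; ¬?; toSum; does-⇔)
open import Relation.Unary using (Decidable)
open import Relation.Binary.Definitions using (tri<; tri≈; tri>)
open import Relation.Binary.PropositionalEquality

-- Counting over 𝔖 n

∈-++-∷⁻ : ∀ {A : Set} {x y : A} as {bs} → y ∈ as ++ x ∷ bs → y ≢ x → y ∈ as ++ bs
∈-++-∷⁻ as y∈ y≢x with ∈-++⁻ as y∈
... | inj₁ y∈as         = ∈-++⁺ˡ y∈as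
... | inj₂ (here y≡x)   = ⊥-elim (y≢x y≡x)
... | inj₂ (there y∈bs) = ∈-++⁺ʳ as y∈bs

length-≤-injection : ∀ {A B : Set} (f : A → B) {xs ys} → Unique xs →
  (∀ {x} → x ∈ xs → f x ∈ ys) →
  (∀ {x y} → x ∈ xs → y ∈ xs → f x ≡ f y → x ≡ y) →
  length xs ≤ length ys
length-≤-injection f {[]} _ _ _ = z≤n
length-≤-injection f {x ∷ xs} {ys} (x∉xs ∷ xs!) into inj
  with as , bs , refl ← ∈-∃++ (into (here refl)) =
  ≤-trans (s≤s (length-≤-injection f xs! into′ (λ p q → inj (there p) (there q))))
          (≤-reflexive (begin
            suc (length (as ++ bs))        ≡⟨ cong suc (length-++ as) ⟩
            suc (length as + length bs)    ≡⟨ +-suc (length as) (length bs) ⟨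
            length as + length (f x ∷ bs)  ≡⟨ length-++ as ⟨
            length (as ++ f x ∷ bs)        ∎))
  where
  open ≡-Reasoning
  into′ : ∀ {y} → y ∈ xs → f y ∈ as ++ bs
  into′ y∈xs = ∈-++-∷⁻ as (into (there y∈xs))
    (λ fy≡fx → All.lookup x∉xs y∈xs (sym (inj (there y∈xs) (here refl) fy≡fx)))

length-filter+length-filter-¬ : ∀ {A : Set} {P : A → Set} (P? : Decidable P) xs →
  length (filter P? xs) + length (filter (¬? ∘ P?) xs) ≡ length xs
length-filter+length-filter-¬ P? [] = refl
length-filter+length-filter-¬ P? (x ∷ xs) with P? x
... | yes _ = cong suc (length-filter+length-filter-¬ P? xs)
... | no _  = trans (+-suc _ _) (cong suc (length-filter+length-filter-¬ P? xs))

module _ {A : Set} {xs : List A} (xs! : Unique xs) (f : A → A)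
  (f-into : ∀ {x} → x ∈ xs → f x ∈ xs)
  (f-inj : ∀ {x y} → x ∈ xs → y ∈ xs → f x ≡ f y → x ≡ y) where

  private
    length-filter-∘-≤ : ∀ {P : A → Set} (P? : Decidable P) →
      length (filter (P? ∘ f) xs) ≤ length (filter P? xs)
    length-filter-∘-≤ P? = length-≤-injection f (filter⁺ (P? ∘ f) xs!)
      (λ x∈ → let x∈xs , Pfx = ∈-filter⁻ (P? ∘ f) x∈ in ∈-filter⁺ P? (f-into x∈xs) Pfx)
      (λ x∈ y∈ → f-inj (proj₁ (∈-filter⁻ (P? ∘ f) x∈)) (proj₁ (∈-filter⁻ (P? ∘ f) y∈)))

  -- The complementary filters have complementary lengths, so neither inequality can be strict.
  length-filter-∘-injection : ∀ {P : A → Set} (P? : Decidable P) →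
    length (filter (P? ∘ f) xs) ≡ length (filter P? xs)
  length-filter-∘-injection P? = ≤-antisym (length-filter-∘-≤ P?) (+-cancelʳ-≤ b′ b a (begin
    b + b′  ≡⟨ length-filter+length-filter-¬ P? xs ⟩
    length xs ≡⟨ length-filter+length-filter-¬ (P? ∘ f) xs ⟨
    a + a′  ≤⟨ +-monoʳ-≤ a (length-filter-∘-≤ (¬? ∘ P?)) ⟩
    a + b′  ∎))
    where
    open ≤-Reasoning
    a a′ b b′ : ℕ
    a = length (filter (P? ∘ f) xs)
    a′ = length (filter (¬? ∘ P? ∘ f) xs)
    b = length (filter P? xs)
    b′ = length (filter (¬? ∘ P?) xs)

filter-cong-∈ : ∀ {A : Set} {P Q : A → Set} (P? : Decidable P) (Q? : Decidable Q) {xs} →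
  (∀ {x} → x ∈ xs → P x → Q x) → (∀ {x} → x ∈ xs → Q x → P x) → filter P? xs ≡ filter Q? xs
filter-cong-∈ P? Q? {[]} _ _ = refl
filter-cong-∈ P? Q? {x ∷ xs} P⇒Q Q⇒P with P? x | Q? x
... | yes _  | yes _  = cong (x ∷_) (filter-cong-∈ P? Q? (P⇒Q ∘ there) (Q⇒P ∘ there))
... | no _   | no _   = filter-cong-∈ P? Q? (P⇒Q ∘ there) (Q⇒P ∘ there)
... | yes Px | no ¬Qx = ⊥-elim (¬Qx (P⇒Q (here refl) Px))
... | no ¬Px | yes Qx = ⊥-elim (¬Px (Q⇒P (here refl) Qx))

concatMap-map≡cartesianProductWith : ∀ {A B C : Set} (g : A → B → C) xs ys →
  concatMap (λ x → map (g x) ys) xs ≡ cartesianProductWith g xs ys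
concatMap-map≡cartesianProductWith g []       ys = refl
concatMap-map≡cartesianProductWith g (x ∷ xs) ys =
  cong (map (g x) ys ++_) (concatMap-map≡cartesianProductWith g xs ys)

∈-words : ∀ n k (w : Vec (Fin n) k) → w ∈ words n k
∈-words n zero    []      = here refl
∈-words n (suc k) (x ∷ w) = subst (x ∷ w ∈_) (sym (concatMap-map≡cartesianProductWith _∷_ (allFin n) (words n k)))
  (∈-cartesianProductWith⁺ _∷_ (∈-allFin x) (∈-words n k w))

words-unique : ∀ n k → Unique (words n k)
words-unique n zero    = [] ∷ []
words-unique n (suc k) = subst Unique (sym (concatMap-map≡cartesianProductWith _∷_ (allFin n) (words n k)))
  (cartesianProductWith⁺ _∷_ ∷-injective (allFin⁺ n) (words-unique n k))

∈-𝔖 : ∀ {n} {w : Vec (Fin n) n} → IsPerm w → w ∈ 𝔖 n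
∈-𝔖 {n} {w} = ∈-filter⁺ isPerm? (∈-words n n w)

∈-𝔖⁻ : ∀ {n} {w : Vec (Fin n) n} → w ∈ 𝔖 n → IsPerm w
∈-𝔖⁻ {n} w∈𝔖 = proj₂ (∈-filter⁻ isPerm? {xs = words n n} w∈𝔖)

module Transport {n} (Φ : Vec (Fin n) n → Vec (Fin n) n)
  (Φ-perm : ∀ w → IsPerm w → IsPerm (Φ w))
  (Φ-inj : ∀ {w w′} → IsPerm w → IsPerm w′ → Φ w ≡ Φ w′ → w ≡ w′) where

  count-transport : ∀ {A : Set} (F G : Vec (Fin n) n → A) → (∀ w → IsPerm w → G (Φ w) ≡ F w) →
    ∀ {P : A → Set} (P? : Decidable P) → count n (P? ∘ F) ≡ count n (P? ∘ G)
  count-transport F G G∘Φ≡F {P} P? = begin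
    length (filter (P? ∘ F) (𝔖 n))
      ≡⟨ cong length (filter-cong-∈ (P? ∘ F) (P? ∘ G ∘ Φ)
           (λ {w} w∈ → subst P (sym (G∘Φ≡F w (∈-𝔖⁻ w∈))))
           (λ {w} w∈ → subst P (G∘Φ≡F w (∈-𝔖⁻ w∈)))) ⟩
    length (filter (P? ∘ G ∘ Φ) (𝔖 n))
      ≡⟨ length-filter-∘-injection (filter⁺ isPerm? (words-unique n n)) Φ
           (λ {w} w∈ → ∈-𝔖 (Φ-perm w (∈-𝔖⁻ w∈))) (λ v∈ w∈ → Φ-inj (∈-𝔖⁻ v∈) (∈-𝔖⁻ w∈))
           (P? ∘ G) ⟩
    length (filter (P? ∘ G) (𝔖 n))
      ∎
    where open ≡-Reasoning

-- Blocks of a word and the cycle permutation σ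

record IsPermutation (m : ℕ) (s : ℕ → ℕ) : Set where
  field
    bounded    : ∀ {k} → k ≤ m → s k ≤ m
    injective  : ∀ {k l} → k ≤ m → l ≤ m → s k ≡ s l → k ≡ l
    surjective : ∀ {v} → v ≤ m → ∃[ k ] k ≤ m × s k ≡ v

witness : ∀ {P : ℕ → Set} {b} → Dec (∃[ k ] k < b × P k) → ℕ
witness (yes (k , _)) = k
witness (no _)        = 0

witness-correct : ∀ {P : ℕ → Set} {b} (d : Dec (∃[ k ] k < b × P k)) →
  ∃[ k ] k < b × P k → witness d < b × P (witness d)
witness-correct (yes (_ , k<b , Pk)) _ = k<b , Pk
witness-correct (no ¬∃)             ∃k = ⊥-elim (¬∃ ∃k)

-- A word s 0 … s m (positions and letters counted from 0) is cut into blocks: the first ends at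
-- the letter m, and each later block starts at a left-to-right minimum of the part after m.
-- Reading every block as a cycle gives the permutation σ of letters; φ is the word σ m, σ 0, …, σ (m ∸ 1).
module Blocks (m : ℕ) (s : ℕ → ℕ) where

  position : ℕ → ℕ
  position v = witness (anyUpTo? (λ k → s k ≟ v) (suc m))

  maxPosition : ℕ
  maxPosition = position m

  Dominated : ℕ → Set
  Dominated k = ∃[ l ] l < k × maxPosition < l × s l ≤ s k

  dominated? : Decidable Dominated
  dominated? k = anyUpTo? (λ l → (maxPosition <? l) ×-dec (s l ≤? s k)) k

  Start : ℕ → Set
  Start k = k ≡ 0 ⊎ (maxPosition < k × ¬ Dominated k)

  End : ℕ → Set
  End k = k ≡ m ⊎ Start (suc k)

  -- Opaque, so that `with start? k` and `with end? k` can abstract them in goals.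
  opaque
    start? : Decidable Start
    start? k = (k ≟ 0) ⊎-dec ((maxPosition <? k) ×-dec ¬? (dominated? k))

    end? : Decidable End
    end? k = (k ≟ m) ⊎-dec start? (suc k)

  blockStart : ℕ → ℕ
  blockStart zero    = zero
  blockStart (suc k) = if does (start? (suc k)) then suc k else blockStart k

  next : ℕ → ℕ
  next k = if does (end? k) then s (blockStart k) else s (suc k)

  σ : ℕ → ℕ
  σ v = next (position v)

  φ : ℕ → ℕ
  φ zero    = σ m
  φ (suc x) = σ x

  AscentPair CyclePair : (ℕ → ℕ → Set) → ℕ → Set
  AscentPair R v = ∃[ i ] i < m × s (suc i) ≡ v × R (s i) (s (suc i))
  CyclePair  R v = ∃[ x ] x < m × σ x ≡ v × R x (σ x)

  InBlock : ℕ → ℕ → Set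
  InBlock b x = ∃[ t ] t ≤ m × blockStart t ≡ b × s t ≡ x

module BlockProperties {m s} (perm : IsPermutation m s) where
  open IsPermutation perm
  open Blocks m s

  position-correct : ∀ {v} → v ≤ m → position v ≤ m × s (position v) ≡ v
  position-correct {v} v≤m with k , k≤m , sk≡v ← surjective v≤m
    with p<1+m , sp≡v ← witness-correct (anyUpTo? (λ k → s k ≟ v) (suc m)) (k , s≤s k≤m , sk≡v) =
    m<1+n⇒m≤n p<1+m , sp≡v

  position-s : ∀ {k} → k ≤ m → position (s k) ≡ k
  position-s k≤m = let p≤m , sp≡sk = position-correct (bounded k≤m) in injective p≤m k≤m sp≡sk

  maxPosition≤m : maxPosition ≤ m
  maxPosition≤m = proj₁ (position-correct ≤-refl)

  s-maxPosition : s maxPosition ≡ m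
  s-maxPosition = proj₂ (position-correct ≤-refl)

  ≡maxPosition : ∀ {k} → k ≤ m → s k ≡ m → k ≡ maxPosition
  ≡maxPosition k≤m sk≡m = injective k≤m maxPosition≤m (trans sk≡m (sym s-maxPosition))

  s<m : ∀ {k} → k ≤ m → k ≢ maxPosition → s k < m
  s<m k≤m k≢M = ≤∧≢⇒< (bounded k≤m) (k≢M ∘ ≡maxPosition k≤m)

  start-suc⇒maxPosition< : ∀ {k} → Start (suc k) → maxPosition < suc k
  start-suc⇒maxPosition< (inj₂ (M<k+1 , _)) = M<k+1

  start-after-max : Start (suc maxPosition)
  start-after-max = inj₂ (≤-refl , λ (l , l<M+1 , M<l , _) → <⇒≱ M<l (m<1+n⇒m≤n l<M+1))

  start-minimal : ∀ {k t} → Start k → t < k → maxPosition < t → s k < s t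
  start-minimal (inj₁ refl)         ()  _
  start-minimal (inj₂ (_ , ¬dom)) t<k M<t = ≰⇒> (λ st≤sk → ¬dom (_ , t<k , M<t , st≤sk))

  ¬start⇒dominated : ∀ {k} → maxPosition < k → ¬ Start k → Dominated k
  ¬start⇒dominated {k} M<k ¬st with dominated? k
  ... | yes dom = dom
  ... | no ¬dom = ⊥-elim (¬st (inj₂ (M<k , ¬dom)))

  descent-into-start : ∀ {k} → suc k ≤ m → Start (suc k) → s (suc k) < s k
  descent-into-start {k} k<m st with m≤n⇒m<n∨m≡n (m<1+n⇒m≤n (start-suc⇒maxPosition< st))
  ... | inj₁ M<k  = start-minimal st ≤-refl M<k
  ... | inj₂ refl = ≤∧≢⇒< (subst (s (suc k) ≤_) (sym s-maxPosition) (bounded k<m))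
                          (λ eq → <⇒≢ (n<1+n k) (sym (injective k<m maxPosition≤m eq)))

  blockStart≤ : ∀ k → blockStart k ≤ k
  blockStart≤ zero = z≤n
  blockStart≤ (suc k) with start? (suc k)
  ... | yes _ = ≤-refl
  ... | no _  = m≤n⇒m≤1+n (blockStart≤ k)

  start-blockStart : ∀ k → Start (blockStart k)
  start-blockStart zero = inj₁ refl
  start-blockStart (suc k) with start? (suc k)
  ... | yes st = st
  ... | no _   = start-blockStart k

  blockStart-maximal : ∀ {t} k → Start t → t ≤ k → t ≤ blockStart k
  blockStart-maximal zero    _  t≤0 = t≤0
  blockStart-maximal (suc k) st t≤k+1 with start? (suc k)
  ... | yes _ = t≤k+1
  ... | no ¬st with m≤n⇒m<n∨m≡n t≤k+1
  ...   | inj₁ t<k+1 = blockStart-maximal k st (m<1+n⇒m≤n t<k+1)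
  ...   | inj₂ refl  = ⊥-elim (¬st st)

  blockStart-start : ∀ {b} → Start b → blockStart b ≡ b
  blockStart-start {b} st = ≤-antisym (blockStart≤ b) (blockStart-maximal b st ≤-refl)

  blockStart-≤max : ∀ k → k ≤ maxPosition → blockStart k ≡ 0
  blockStart-≤max zero    _      = refl
  blockStart-≤max (suc k) k+1≤M with start? (suc k)
  ... | yes st = ⊥-elim (<⇒≱ (start-suc⇒maxPosition< st) k+1≤M)
  ... | no _   = blockStart-≤max k (≤-trans (n≤1+n k) k+1≤M)

  blockStart-after-max : ∀ {k} → maxPosition < k → maxPosition < blockStart k
  blockStart-after-max {k} = blockStart-maximal k start-after-max

  blockStart-suc : ∀ {k} → ¬ End k → blockStart (suc k) ≡ blockStart k
  blockStart-suc {k} ¬ek with start? (suc k)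
  ... | yes st = ⊥-elim (¬ek (inj₂ st))
  ... | no _   = refl

  blockStart-minimal : ∀ {t} k → maxPosition < t → t ≤ k → s (blockStart k) ≤ s t
  blockStart-minimal zero () z≤n
  blockStart-minimal (suc k) M<t t≤k+1 with start? (suc k) | m≤n⇒m<n∨m≡n t≤k+1
  ... | yes st  | inj₁ t<k+1 = <⇒≤ (start-minimal st t<k+1 M<t)
  ... | yes _   | inj₂ refl  = ≤-refl
  ... | no ¬st  | t≤k+1′ with m≤n⇒m<n∨m≡n (m<1+n⇒m≤n (<-≤-trans M<t t≤k+1))
  ...   | inj₂ refl = ⊥-elim (¬st start-after-max)
  ...   | inj₁ M<k with t≤k+1′
  ...     | inj₁ t<k+1 = blockStart-minimal k M<t (m<1+n⇒m≤n t<k+1)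
  ...     | inj₂ refl with l , l<k+1 , M<l , sl≤ ← ¬start⇒dominated M<t ¬st =
    ≤-trans (blockStart-minimal k M<l (m<1+n⇒m≤n l<k+1)) sl≤

  end⇒maxPosition≤ : ∀ {k} → End k → maxPosition ≤ k
  end⇒maxPosition≤ (inj₁ refl) = maxPosition≤m
  end⇒maxPosition≤ (inj₂ st)   = m<1+n⇒m≤n (start-suc⇒maxPosition< st)

  s-blockStart≤ : ∀ {k} → maxPosition ≤ k → k ≤ m → s (blockStart k) ≤ s k
  s-blockStart≤ {k} M≤k k≤m with m≤n⇒m<n∨m≡n M≤k
  ... | inj₁ M<k  = blockStart-minimal k M<k ≤-refl
  ... | inj₂ refl = subst (s (blockStart k) ≤_) (sym s-maxPosition) (bounded (≤-trans (blockStart≤ k) k≤m))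

  end⇒start-suc : ∀ {k} → k < m → End k → Start (suc k)
  end⇒start-suc k<m (inj₁ refl) = ⊥-elim (<-irrefl refl k<m)
  end⇒start-suc k<m (inj₂ st)   = st

  ¬end⇒<m : ∀ {k} → k ≤ m → ¬ End k → k < m
  ¬end⇒<m k≤m ¬ek = ≤∧≢⇒< k≤m (¬ek ∘ inj₁)

  end⇒blockStart< : ∀ {k l} → End k → k < l → l ≤ m → blockStart k < blockStart l
  end⇒blockStart< (inj₁ refl) k<l l≤m = ⊥-elim (<⇒≱ k<l l≤m)
  end⇒blockStart< {k} {l} (inj₂ st) k<l l≤m = ≤-<-trans (blockStart≤ k) (blockStart-maximal l st k<l)

  ends-of-same-block : ∀ {k l} → End k → End l → k ≤ m → l ≤ m → blockStart k ≡ blockStart l → k ≡ l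
  ends-of-same-block {k} {l} ek el k≤m l≤m bk≡bl with <-cmp k l
  ... | tri< k<l _ _ = ⊥-elim (<⇒≢ (end⇒blockStart< ek k<l l≤m) bk≡bl)
  ... | tri≈ _ k≡l _ = k≡l
  ... | tri> _ _ l<k = ⊥-elim (<⇒≢ (end⇒blockStart< el l<k k≤m) (sym bk≡bl))

  next-end : ∀ {k} → End k → next k ≡ s (blockStart k)
  next-end {k} ek with end? k
  ... | yes _  = refl
  ... | no ¬ek = ⊥-elim (¬ek ek)

  next-¬end : ∀ {k} → ¬ End k → next k ≡ s (suc k)
  next-¬end {k} ¬ek with end? k
  ... | yes ek = ⊥-elim (¬ek ek)
  ... | no _   = refl

  next-bounded : ∀ {k} → k ≤ m → next k ≤ m
  next-bounded {k} k≤m with end? k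
  ... | yes _  = bounded (≤-trans (blockStart≤ k) k≤m)
  ... | no ¬ek = bounded (¬end⇒<m k≤m ¬ek)

  next-injective : ∀ {k l} → k ≤ m → l ≤ m → next k ≡ next l → k ≡ l
  next-injective {k} {l} k≤m l≤m eq with end? k | end? l
  ... | no ¬ek | no ¬el = suc-injective (injective (¬end⇒<m k≤m ¬ek) (¬end⇒<m l≤m ¬el) eq)
  ... | no ¬ek | yes _  = ⊥-elim (¬ek (inj₂ (subst Start
          (injective (≤-trans (blockStart≤ l) l≤m) (¬end⇒<m k≤m ¬ek) (sym eq)) (start-blockStart l))))
  ... | yes _  | no ¬el = ⊥-elim (¬el (inj₂ (subst Start
          (injective (≤-trans (blockStart≤ k) k≤m) (¬end⇒<m l≤m ¬el) eq) (start-blockStart k))))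
  ... | yes ek | yes el =
    ends-of-same-block ek el k≤m l≤m (injective (≤-trans (blockStart≤ k) k≤m) (≤-trans (blockStart≤ l) l≤m) eq)

  σ-s : ∀ {k} → k ≤ m → σ (s k) ≡ next k
  σ-s k≤m = cong next (position-s k≤m)

  σ-m : σ m ≡ s 0
  σ-m = trans (next-end (inj₂ start-after-max)) (cong s (blockStart-≤max maxPosition ≤-refl))

  σ-bounded : ∀ {v} → v ≤ m → σ v ≤ m
  σ-bounded v≤m = next-bounded (proj₁ (position-correct v≤m))

  σ-injective : ∀ {v w} → v ≤ m → w ≤ m → σ v ≡ σ w → v ≡ w
  σ-injective {v} {w} v≤m w≤m eq = begin
    v                 ≡⟨ proj₂ (position-correct v≤m) ⟨
    s (position v)    ≡⟨ cong s (next-injective (proj₁ (position-correct v≤m)) (proj₁ (position-correct w≤m)) eq) ⟩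
    s (position w)    ≡⟨ proj₂ (position-correct w≤m) ⟩
    w                 ∎
    where open ≡-Reasoning

  φ-bounded : ∀ {j} → j ≤ m → φ j ≤ m
  φ-bounded {zero}  _     = σ-bounded ≤-refl
  φ-bounded {suc x} x<m   = σ-bounded (<⇒≤ x<m)

  φ-injective : ∀ {j j′} → j ≤ m → j′ ≤ m → φ j ≡ φ j′ → j ≡ j′
  φ-injective {zero}  {zero}   _   _   _  = refl
  φ-injective {zero}  {suc y}  _   y<m eq = ⊥-elim (<-irrefl (σ-injective (<⇒≤ y<m) ≤-refl (sym eq)) y<m)
  φ-injective {suc x} {zero}   x<m _   eq = ⊥-elim (<-irrefl (σ-injective (<⇒≤ x<m) ≤-refl eq) x<m)
  φ-injective {suc x} {suc y}  x<m y<m eq = cong suc (σ-injective (<⇒≤ x<m) (<⇒≤ y<m) eq)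

  walk-to-end : ∀ (P : ℕ → Set) {k} → k ≤ m → P k → (∀ {t} → t < m → ¬ End t → P t → P (suc t)) →
    ∃[ e ] e ≤ m × End e × blockStart e ≡ blockStart k × P e
  walk-to-end P {k} k≤m Pk step = go (m ∸ k) (m+[n∸m]≡n k≤m) Pk
    where
    go : ∀ d {t} → t + d ≡ m → P t → ∃[ e ] e ≤ m × End e × blockStart e ≡ blockStart t × P e
    go d {t} t+d≡m Pt with end? t
    ... | yes et = t , subst (t ≤_) t+d≡m (m≤m+n t d) , et , refl , Pt
    go zero {t} t+0≡m Pt | no ¬et = ⊥-elim (¬et (inj₁ (trans (sym (+-identityʳ t)) t+0≡m)))
    go (suc d) {t} t+d+1≡m Pt | no ¬et
      with e , e≤m , ee , be≡ , Pe ← go d (trans (sym (+-suc t d)) t+d+1≡m)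
                                       (step (subst (t <_) t+d+1≡m (m<m+n t z<s)) ¬et Pt) =
      e , e≤m , ee , trans be≡ (blockStart-suc ¬et) , Pe

  inBlock-σ : ∀ {b x} → InBlock b x → InBlock b (σ x)
  inBlock-σ {b} (t , t≤m , bt≡b , refl) with end? t
  ... | yes et = b , ≤-trans (≤-reflexive (sym bt≡b)) (≤-trans (blockStart≤ t) t≤m) ,
                 subst (λ c → blockStart c ≡ c) bt≡b (blockStart-start (start-blockStart t)) ,
                 sym (trans (σ-s t≤m) (trans (next-end et) (cong s bt≡b)))
  ... | no ¬et = suc t , ¬end⇒<m t≤m ¬et , trans (blockStart-suc ¬et) bt≡b ,
                 sym (trans (σ-s t≤m) (next-¬end ¬et))

  inBlock-≥ : ∀ {b x} → maxPosition < b → InBlock b x → s b ≤ x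
  inBlock-≥ M<b (t , _ , bt≡b , refl) = subst (λ c → s c ≤ s t) bt≡b
    (blockStart-minimal t (<-≤-trans M<b (≤-trans (≤-reflexive (sym bt≡b)) (blockStart≤ t))) ≤-refl)

  ascent⇒¬end : ∀ {i} → i < m → s i < s (suc i) → ¬ End i
  ascent⇒¬end i<m _   (inj₁ refl) = <-irrefl refl i<m
  ascent⇒¬end i<m asc (inj₂ st)   = <-asym asc (descent-into-start i<m st)

  ascentPair⇒cyclePair : ∀ {R} → (∀ {a b} → R a b → a < b) → ∀ {v} → AscentPair R v → CyclePair R v
  ascentPair⇒cyclePair {R} R⇒< (i , i<m , refl , r) =
    s i , <-≤-trans (R⇒< r) (bounded i<m) , σsi≡ , subst (R (s i)) (sym σsi≡) r
    where
    σsi≡ : σ (s i) ≡ s (suc i)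
    σsi≡ = trans (σ-s (<⇒≤ i<m)) (next-¬end (ascent⇒¬end i<m (R⇒< r)))

  cyclePair⇒ascentPair : ∀ {R} → (∀ {a b} → R a b → a < b) → ∀ {v} → CyclePair R v → AscentPair R v
  cyclePair⇒ascentPair {R} R⇒< (x , x<m , refl , r)
    with k≤m , sk≡x ← position-correct (<⇒≤ x<m) =
    k , ¬end⇒<m k≤m ¬ek , sym (next-¬end ¬ek) , subst₂ R (sym sk≡x) (next-¬end ¬ek) r
    where
    k : ℕ
    k = position x
    ¬ek : ¬ End k
    ¬ek ek = <⇒≱ (R⇒< r) (subst (next k ≤_) sk≡x
               (subst (_≤ s k) (sym (next-end ek)) (s-blockStart≤ (end⇒maxPosition≤ ek) k≤m)))

  descent⇒cycleDrop : ∀ {v} → AscentPair (λ a b → b < a) v → CyclePair (λ a b → b < suc a) v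
  descent⇒cycleDrop (i , i<m , refl , desc) with start? (suc i)
  ... | no ¬st = s i , si<m , σsi≡ , subst (_< suc (s i)) (sym σsi≡) (m<n⇒m<1+n desc)
    where
    si<m : s i < m
    si<m = s<m (<⇒≤ i<m) (λ { refl → ¬st start-after-max })
    σsi≡ : σ (s i) ≡ s (suc i)
    σsi≡ = trans (σ-s (<⇒≤ i<m)) (next-¬end (¬st ∘ end⇒start-suc i<m))
  ... | yes st with e , e≤m , ee , be≡ , _ ← walk-to-end (const ⊤) i<m tt (λ _ _ _ → tt) =
    s e , se<m , σse≡ , subst (_< suc (s e)) (sym σse≡)
      (s≤s (subst (λ c → s c ≤ s e) be≡i+1 (s-blockStart≤ (end⇒maxPosition≤ ee) e≤m)))
    where
    be≡i+1 : blockStart e ≡ suc i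
    be≡i+1 = trans be≡ (blockStart-start st)
    se<m : s e < m
    se<m = s<m e≤m (<⇒≢ (<-≤-trans (start-suc⇒maxPosition< st) (subst (_≤ e) be≡i+1 (blockStart≤ e))) ∘ sym)
    σse≡ : σ (s e) ≡ s (suc i)
    σse≡ = trans (σ-s e≤m) (trans (next-end ee) (cong s be≡i+1))

  descent-at-start : ∀ {b} → maxPosition < b → b ≤ m → Start b → AscentPair (λ a c → c < a) (s b)
  descent-at-start {suc i} _ i<m st = i , i<m , refl , descent-into-start i<m st

  cycleDrop⇒descent : ∀ {v} → CyclePair (λ a b → b < suc a) v → AscentPair (λ a b → b < a) v
  cycleDrop⇒descent (x , x<m , refl , r) with k≤m , sk≡x ← position-correct (<⇒≤ x<m) | toSum (end? (position x))
  ... | inj₂ ¬ek = k , ¬end⇒<m k≤m ¬ek , sym (next-¬end ¬ek) , desc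
    where
    k : ℕ
    k = position x
    desc : s (suc k) < s k
    desc = ≤∧≢⇒< (subst₂ _≤_ (next-¬end ¬ek) (sym sk≡x) (m<1+n⇒m≤n r))
                 (λ eq → <⇒≢ (n<1+n k) (sym (injective (¬end⇒<m k≤m ¬ek) k≤m eq)))
  ... | inj₁ ek = subst (AscentPair (λ a b → b < a)) (sym (next-end ek))
    (descent-at-start (blockStart-after-max M<k) (≤-trans (blockStart≤ k) k≤m) (start-blockStart k))
    where
    k : ℕ
    k = position x
    M<k : maxPosition < k
    M<k = ≤∧≢⇒< (end⇒maxPosition≤ ek)
            (λ M≡k → <-irrefl (trans (sym sk≡x) (trans (cong s (sym M≡k)) s-maxPosition)) x<m)

  ascentPair⇔cyclePair : ∀ {R} → (∀ {a b} → R a b → a < b) → ∀ {v} → AscentPair R v ⇔ CyclePair R v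
  ascentPair⇔cyclePair R⇒< = mk⇔ (ascentPair⇒cyclePair R⇒<) (cyclePair⇒ascentPair R⇒<)

  descent⇔cycleDrop : ∀ {v} → AscentPair (λ a b → b < a) v ⇔ CyclePair (λ a b → b < suc a) v
  descent⇔cycleDrop = mk⇔ descent⇒cycleDrop cycleDrop⇒descent


-- σ determines the word

module Comparison {m s s′} (perm : IsPermutation m s) (perm′ : IsPermutation m s′)
  (σ-agree : ∀ {x} → x ≤ m → Blocks.σ m s x ≡ Blocks.σ m s′ x) where
  open IsPermutation perm
  open Blocks m s
  open BlockProperties perm
  module B′ = Blocks m s′
  module P′ = BlockProperties perm′
  open IsPermutation perm′ using () renaming (bounded to bounded′)

  AgreeUpTo : ℕ → Set
  AgreeUpTo k = ∀ {t} → t ≤ k → s t ≡ s′ t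

  next-agree : ∀ {k} → k ≤ m → AgreeUpTo k → next k ≡ B′.next k
  next-agree {k} k≤m agree = begin
    next k         ≡⟨ σ-s k≤m ⟨
    σ (s k)        ≡⟨ cong σ (agree ≤-refl) ⟩
    σ (s′ k)       ≡⟨ σ-agree (bounded′ k≤m) ⟩
    B′.σ (s′ k)    ≡⟨ P′.σ-s k≤m ⟩
    B′.next k      ∎
    where open ≡-Reasoning

  ¬end⇒¬end′ : ∀ {k} → k < m → AgreeUpTo k → ¬ End k → ¬ B′.End k
  ¬end⇒¬end′ {k} k<m agree ¬ek ek′ = <⇒≱ (s≤s ≤-refl) (≤-trans (≤-reflexive k+1≡b′) (P′.blockStart≤ k))
    where
    k+1≡b′ : suc k ≡ B′.blockStart k
    k+1≡b′ = injective k<m (≤-trans (P′.blockStart≤ k) (<⇒≤ k<m)) (begin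
      s (suc k)                  ≡⟨ next-¬end ¬ek ⟨
      next k                     ≡⟨ next-agree (<⇒≤ k<m) agree ⟩
      B′.next k                  ≡⟨ P′.next-end ek′ ⟩
      s′ (B′.blockStart k)       ≡⟨ agree (P′.blockStart≤ k) ⟨
      s (B′.blockStart k)        ∎)
      where open ≡-Reasoning

  -- The block of s starting at k + 1 is σ-invariant and bounded below by s (k + 1), while the
  -- σ-orbit of s (k + 1) runs through the start of the block of s′ containing it.
  start-start⇒≤ : ∀ {k} → k < m → AgreeUpTo k → Start (suc k) → B′.Start (suc k) → s (suc k) ≤ s′ (suc k)
  start-start⇒≤ {k} k<m agree st st′ with p≤m , s′p≡v ← P′.position-correct (bounded k<m) =
    ≤-trans (inBlock-≥ (start-suc⇒maxPosition< st) inBlock-b′)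
            (P′.blockStart-minimal p (P′.start-suc⇒maxPosition< st′) k<p)
    where
    p : ℕ
    p = B′.position (s (suc k))
    k<p : k < p
    k<p = ≰⇒> λ p≤k → <⇒≱ (s≤s p≤k) (≤-reflexive (injective k<m (≤-trans p≤k (<⇒≤ k<m))
            (trans (sym s′p≡v) (sym (agree p≤k)))))
    step : ∀ {t} → t < m → ¬ B′.End t → InBlock (suc k) (s′ t) → InBlock (suc k) (s′ (suc t))
    step t<m ¬et′ inb = subst (InBlock (suc k))
      (trans (σ-agree (bounded′ (<⇒≤ t<m))) (trans (P′.σ-s (<⇒≤ t<m)) (P′.next-¬end ¬et′)))
      (inBlock-σ inb)
    inBlock-b′ : InBlock (suc k) (s′ (B′.blockStart p))
    inBlock-b′ with e , e≤m , ee′ , be≡bp , inb ← P′.walk-to-end (InBlock (suc k) ∘ s′) p≤m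
                  (suc k , k<m , blockStart-start st , sym s′p≡v) step =
      subst (InBlock (suc k))
        (trans (σ-agree (bounded′ e≤m)) (trans (P′.σ-s e≤m) (trans (P′.next-end ee′) (cong s′ be≡bp))))
        (inBlock-σ inb)

σ-determines-word : ∀ {m s s′} → IsPermutation m s → IsPermutation m s′ →
  (∀ {x} → x ≤ m → Blocks.σ m s x ≡ Blocks.σ m s′ x) → ∀ {t} → t ≤ m → s t ≡ s′ t
σ-determines-word {m} {s} {s′} perm perm′ σ-agree t≤m = agree m ≤-refl t≤m
  where
  module P = BlockProperties perm
  module P′ = BlockProperties perm′
  module C = Comparison perm perm′ σ-agree
  module C′ = Comparison perm′ perm (sym ∘ σ-agree)

  step : ∀ {k} → k < m → C.AgreeUpTo k → s (suc k) ≡ s′ (suc k)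
  step {k} k<m agree with toSum (Blocks.end? m s k) | toSum (Blocks.end? m s′ k)
  ... | inj₂ ¬ek | inj₂ ¬ek′ =
    trans (sym (P.next-¬end ¬ek)) (trans (C.next-agree (<⇒≤ k<m) agree) (P′.next-¬end ¬ek′))
  ... | inj₂ ¬ek | inj₁ ek′  = ⊥-elim (C.¬end⇒¬end′ k<m agree ¬ek ek′)
  ... | inj₁ ek  | inj₂ ¬ek′ = ⊥-elim (C′.¬end⇒¬end′ k<m (sym ∘ agree) ¬ek′ ek)
  ... | inj₁ ek  | inj₁ ek′  =
    ≤-antisym (C.start-start⇒≤ k<m agree st st′) (C′.start-start⇒≤ k<m (sym ∘ agree) st′ st)
    where
    st : Blocks.Start m s (suc k)
    st = P.end⇒start-suc k<m ek
    st′ : Blocks.Start m s′ (suc k)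
    st′ = P′.end⇒start-suc k<m ek′

  agree : ∀ k → k ≤ m → C.AgreeUpTo k
  agree zero    _   z≤n = trans (sym P.σ-m) (trans (σ-agree ≤-refl) P′.σ-m)
  agree (suc k) k<m t≤k+1 with m≤n⇒m<n∨m≡n t≤k+1
  ... | inj₁ t<k+1 = agree k (<⇒≤ k<m) (m<1+n⇒m≤n t<k+1)
  ... | inj₂ refl  = step k<m (agree k (<⇒≤ k<m))

-- Words over Fin as words over ℕ

injective⇒surjective : ∀ {n} {f : Fin n → Fin n} → Injective _≡_ _≡_ f → ∀ y → ∃[ x ] f x ≡ y
injective⇒surjective {suc n} {f} f-inj y with any? (λ x → f x FinP.≟ y)
... | yes hit = hit
... | no ¬hit = contradiction (injective⇒≤ g-inj) 1+n≰n
  where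
  y≢f : ∀ x → y ≢ f x
  y≢f x y≡fx = ¬hit (x , sym y≡fx)
  g-inj : Injective _≡_ _≡_ (λ x → punchOut (y≢f x))
  g-inj eq = f-inj (punchOut-injective (y≢f _) (y≢f _) eq)

toℕ-mod : ∀ {m k} → k ≤ m → toℕ (k mod suc m) ≡ k
toℕ-mod k≤m = trans (toℕ-fromℕ< _) (m≤n⇒m%n≡m k≤m)

toℕ-mod-suc : ∀ {m} (i : Fin (suc m)) → toℕ i mod suc m ≡ i
toℕ-mod-suc i = toℕ-injective (toℕ-mod (toℕ≤pred[n] i))

-- Positions beyond m are reduced modulo m + 1; only the values on 0 … m matter.
wordℕ : ∀ {m} → Vec (Fin (suc m)) (suc m) → ℕ → ℕ
wordℕ {m} w k = toℕ (lookup w (k mod suc m))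

wordℕ-toℕ : ∀ {m} (w : Vec (Fin (suc m)) (suc m)) i → wordℕ w (toℕ i) ≡ toℕ (lookup w i)
wordℕ-toℕ w i = cong (toℕ ∘ lookup w) (toℕ-mod-suc i)

wordℕ-isPermutation : ∀ {m} (w : Vec (Fin (suc m)) (suc m)) → IsPerm w → IsPermutation m (wordℕ w)
wordℕ-isPermutation {m} w w-perm = record
  { bounded    = λ {k} _ → toℕ≤pred[n] (lookup w (k mod suc m))
  ; injective  = λ k≤m l≤m eq →
      trans (sym (toℕ-mod k≤m)) (trans (cong toℕ (w-perm _ _ (toℕ-injective eq))) (toℕ-mod l≤m))
  ; surjective = surjective
  }
  where
  surjective : ∀ {v} → v ≤ m → ∃[ k ] k ≤ m × wordℕ w k ≡ v
  surjective {v} v≤m with i , wi≡v ← injective⇒surjective (λ {i} {j} → w-perm i j) (v mod suc m) =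
    toℕ i , toℕ≤pred[n] i , trans (wordℕ-toℕ w i) (trans (cong toℕ wi≡v) (toℕ-mod v≤m))

Φ : ∀ {m} → Vec (Fin (suc m)) (suc m) → Vec (Fin (suc m)) (suc m)
Φ {m} w = tabulate (λ j → Blocks.φ m (wordℕ w) (toℕ j) mod suc m)

module _ {m} (w : Vec (Fin (suc m)) (suc m)) (w-perm : IsPerm w) where
  open Blocks m (wordℕ w)
  open BlockProperties (wordℕ-isPermutation w w-perm)

  toℕ-lookup-Φ : ∀ j → toℕ (lookup (Φ w) j) ≡ φ (toℕ j)
  toℕ-lookup-Φ j = trans (cong toℕ (lookup∘tabulate (λ i → φ (toℕ i) mod suc m) j))
                         (toℕ-mod (φ-bounded (toℕ≤pred[n] j)))

  Φ-isPerm : IsPerm (Φ w)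
  Φ-isPerm i j eq = toℕ-injective (φ-injective (toℕ≤pred[n] i) (toℕ≤pred[n] j)
    (trans (sym (toℕ-lookup-Φ i)) (trans (cong toℕ eq) (toℕ-lookup-Φ j))))

Φ-injective : ∀ {m} {w w′ : Vec (Fin (suc m)) (suc m)} → IsPerm w → IsPerm w′ → Φ w ≡ Φ w′ → w ≡ w′
Φ-injective {m} {w} {w′} w-perm w′-perm Φw≡Φw′ =
  trans (sym (tabulate∘lookup w)) (trans (tabulate-cong lookup-agree) (tabulate∘lookup w′))
  where
  φ-agree : ∀ {j} → j ≤ m → Blocks.φ m (wordℕ w) j ≡ Blocks.φ m (wordℕ w′) j
  φ-agree {j} j≤m = begin
    Blocks.φ m (wordℕ w) j                     ≡⟨ cong (Blocks.φ m (wordℕ w)) (toℕ-mod j≤m) ⟨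
    Blocks.φ m (wordℕ w) (toℕ (j mod suc m))   ≡⟨ toℕ-lookup-Φ w w-perm (j mod suc m) ⟨
    toℕ (lookup (Φ w) (j mod suc m))           ≡⟨ cong (λ v → toℕ (lookup v (j mod suc m))) Φw≡Φw′ ⟩
    toℕ (lookup (Φ w′) (j mod suc m))          ≡⟨ toℕ-lookup-Φ w′ w′-perm (j mod suc m) ⟩
    Blocks.φ m (wordℕ w′) (toℕ (j mod suc m))  ≡⟨ cong (Blocks.φ m (wordℕ w′)) (toℕ-mod j≤m) ⟩
    Blocks.φ m (wordℕ w′) j                    ∎
    where open ≡-Reasoning
  σ-agree : ∀ {x} → x ≤ m → Blocks.σ m (wordℕ w) x ≡ Blocks.σ m (wordℕ w′) x
  σ-agree x≤m with m≤n⇒m<n∨m≡n x≤m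
  ... | inj₁ x<m = φ-agree x<m
  ... | inj₂ refl = φ-agree z≤n
  lookup-agree : ∀ i → lookup w i ≡ lookup w′ i
  lookup-agree i = toℕ-injective (begin
    toℕ (lookup w i)     ≡⟨ wordℕ-toℕ w i ⟨
    wordℕ w (toℕ i)      ≡⟨ σ-determines-word (wordℕ-isPermutation w w-perm) (wordℕ-isPermutation w′ w′-perm)
                              σ-agree (toℕ≤pred[n] i) ⟩
    wordℕ w′ (toℕ i)     ≡⟨ wordℕ-toℕ w′ i ⟩
    toℕ (lookup w′ i)    ∎)
    where open ≡-Reasoning

-- Value sets of the statistics

∣tabulate-false∣ : ∀ n → ∣ tabulate {n = n} (λ _ → false) ∣ ≡ 0
∣tabulate-false∣ zero    = refl
∣tabulate-false∣ (suc n) = ∣tabulate-false∣ n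

∣tabulate-≟∣ : ∀ {n} (c : Fin n) → ∣ tabulate (λ v → does (c FinP.≟ v)) ∣ ≡ 1
∣tabulate-≟∣ {suc n} Fin.zero    = cong suc (∣tabulate-false∣ n)
∣tabulate-≟∣ {suc n} (Fin.suc c) = ∣tabulate-≟∣ c

∣tabulate-∨∣ : ∀ {n} (f g : Fin n → Bool) → (∀ v → f v ∧ g v ≡ false) →
  ∣ tabulate (λ v → f v ∨ g v) ∣ ≡ ∣ tabulate f ∣ + ∣ tabulate g ∣
∣tabulate-∨∣ {zero}  f g disjoint = refl
∣tabulate-∨∣ {suc n} f g disjoint
  with f Fin.zero | g Fin.zero | disjoint Fin.zero | ∣tabulate-∨∣ (f ∘ Fin.suc) (g ∘ Fin.suc) (disjoint ∘ Fin.suc)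
... | true  | true  | () | _
... | true  | false | _  | ih = cong suc ih
... | false | true  | _  | ih = trans (cong suc ih) (sym (+-suc _ _))
... | false | false | _  | ih = ih

∣∷∣ : ∀ {n} b (p : Subset n) → ∣ b ∷ p ∣ ≡ (if b then 1 else 0) + ∣ p ∣
∣∷∣ true  p = refl
∣∷∣ false p = refl

does-∧-false : ∀ {A B : Set} (a? : Dec A) (b? : Dec B) → (A → B → ⊥) → does a? ∧ does b? ≡ false
does-∧-false (no _)  _       _ = refl
does-∧-false (yes _) (no _)  _ = refl
does-∧-false (yes a) (yes b) ¬ab = contradiction b (¬ab a)

∣image∣ : ∀ {m n} {q : Fin m → Fin n} → Injective _≡_ _≡_ q → ∀ {P : Fin m → Set} (P? : Decidable P) →
  ∣ tabulate (λ v → does (any? λ i → (q i FinP.≟ v) ×-dec P? i)) ∣ ≡ ∣ tabulate (does ∘ P?) ∣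
∣image∣ {zero}  {n}         _     _  = ∣tabulate-false∣ n
∣image∣ {suc m} {n} {q} q-inj P? = begin
  ∣ tabulate (λ v → (does (q Fin.zero FinP.≟ v) ∧ does (P? Fin.zero)) ∨ G v) ∣
    ≡⟨ ∣tabulate-∨∣ _ G disjoint ⟩
  ∣ tabulate (λ v → does (q Fin.zero FinP.≟ v) ∧ does (P? Fin.zero)) ∣ + ∣ tabulate G ∣
    ≡⟨ cong₂ _+_ (∣q₀-∧∣ (does (P? Fin.zero))) (∣image∣ (FinP.suc-injective ∘ q-inj) (P? ∘ Fin.suc)) ⟩
  (if does (P? Fin.zero) then 1 else 0) + ∣ tabulate (does ∘ P? ∘ Fin.suc) ∣
    ≡⟨ ∣∷∣ (does (P? Fin.zero)) (tabulate (does ∘ P? ∘ Fin.suc)) ⟨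
  ∣ tabulate (does ∘ P?) ∣
    ∎
  where
  open ≡-Reasoning
  G : Fin n → Bool
  G v = does (any? λ i → (q (Fin.suc i) FinP.≟ v) ×-dec P? (Fin.suc i))
  disjoint : ∀ v → (does (q Fin.zero FinP.≟ v) ∧ does (P? Fin.zero)) ∧ G v ≡ false
  disjoint v with q Fin.zero FinP.≟ v | any? (λ i → (q (Fin.suc i) FinP.≟ v) ×-dec P? (Fin.suc i))
  ... | no _      | _                      = refl
  ... | yes _     | no _                   = ∧-zeroʳ _
  ... | yes q0≡v  | yes (i , qi≡v , _)     = contradiction (q-inj (trans q0≡v (sym qi≡v))) λ ()
  ∣q₀-∧∣ : ∀ b → ∣ tabulate (λ v → does (q Fin.zero FinP.≟ v) ∧ b) ∣ ≡ (if b then 1 else 0)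
  ∣q₀-∧∣ true  = trans (cong ∣_∣ (tabulate-cong (λ v → ∧-identityʳ (does (q Fin.zero FinP.≟ v)))))
                      (∣tabulate-≟∣ (q Fin.zero))
  ∣q₀-∧∣ false = trans (cong ∣_∣ (tabulate-cong (λ v → ∧-zeroʳ (does (q Fin.zero FinP.≟ v)))))
                      (∣tabulate-false∣ n)

<⇔bigAscent⊎succession : ∀ {a b} → a < b ⇔ (a + 2 ≤ b ⊎ b ≡ suc a)
<⇔bigAscent⊎succession {a} {b} = mk⇔ to from
  where
  to : a < b → a + 2 ≤ b ⊎ b ≡ suc a
  to a<b with m≤n⇒m<n∨m≡n a<b
  ... | inj₁ a+1<b = inj₁ (subst (_≤ b) (+-comm 2 a) a+1<b)
  ... | inj₂ a+1≡b = inj₂ (sym a+1≡b)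
  from : a + 2 ≤ b ⊎ b ≡ suc a → a < b
  from (inj₁ a+2≤b) = <⇒≤ (subst (_≤ b) (+-comm a 2) a+2≤b)
  from (inj₂ refl)  = ≤-reflexive refl

module Statistics {m} (w : Vec (Fin (suc m)) (suc m)) (w-perm : IsPerm w) where
  open Blocks m (wordℕ w)
  open BlockProperties (wordℕ-isPermutation w w-perm)

  private
    toℕ-lookup-inject₁ : ∀ (i : Fin m) → toℕ (lookup w (inject₁ i)) ≡ wordℕ w (toℕ i)
    toℕ-lookup-inject₁ i = trans (sym (wordℕ-toℕ w (inject₁ i))) (cong (wordℕ w) (toℕ-inject₁ i))

  PairValue : (ℕ → ℕ → Set) → Fin (suc m) → Set
  PairValue R v = ∃[ i ] lookup w (Fin.suc i) ≡ v × R (toℕ (lookup w (inject₁ i))) (toℕ (lookup w (Fin.suc i)))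

  pairValue? : ∀ {R} → (∀ a b → Dec (R a b)) → Decidable (PairValue R)
  pairValue? R? v = any? λ i →
    (lookup w (Fin.suc i) FinP.≟ v) ×-dec R? (toℕ (lookup w (inject₁ i))) (toℕ (lookup w (Fin.suc i)))

  PositionValue : (Fin (suc m) → Fin (suc m) → Set) → Fin (suc m) → Set
  PositionValue Q v = ∃[ j ] 1 ≤ toℕ j × (lookup (Φ w) j ≡ v × Q j (lookup (Φ w) j))

  positionValue? : ∀ {Q} → (∀ j u → Dec (Q j u)) → Decidable (PositionValue Q)
  positionValue? Q? v = any? λ j → (1 ℕ.≤? toℕ j) ×-dec ((lookup (Φ w) j FinP.≟ v) ×-dec Q? j (lookup (Φ w) j))

  pairValue⇔ascentPair : ∀ {R} v → PairValue R v ⇔ AscentPair R (toℕ v)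
  pairValue⇔ascentPair {R} v = mk⇔ to from
    where
    to : PairValue R v → AscentPair R (toℕ v)
    to (i , wi+1≡v , r) = toℕ i , toℕ<n i , trans (wordℕ-toℕ w (Fin.suc i)) (cong toℕ wi+1≡v) ,
                          subst₂ R (toℕ-lookup-inject₁ i) (sym (wordℕ-toℕ w (Fin.suc i))) r
    from : AscentPair R (toℕ v) → PairValue R v
    from (i , i<m , eq , r) with fromℕ< i<m | toℕ-fromℕ< i<m
    ... | f | refl = f , toℕ-injective (trans (sym (wordℕ-toℕ w (Fin.suc f))) eq) ,
                     subst₂ R (sym (toℕ-lookup-inject₁ f)) (wordℕ-toℕ w (Fin.suc f)) r

  positionValue⇔cyclePair : ∀ {Q R} → (∀ x u → Q (Fin.suc x) u ⇔ R (toℕ x) (toℕ u)) →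
    ∀ v → PositionValue Q v ⇔ CyclePair R (toℕ v)
  positionValue⇔cyclePair {Q} {R} Q⇔R v = mk⇔ to from
    where
    to : PositionValue Q v → CyclePair R (toℕ v)
    to (Fin.suc x , _ , eq , q) = toℕ x , toℕ<n x ,
      trans (sym (toℕ-lookup-Φ w w-perm (Fin.suc x))) (cong toℕ eq) ,
      subst (R (toℕ x)) (toℕ-lookup-Φ w w-perm (Fin.suc x)) (Equivalence.to (Q⇔R x _) q)
    from : CyclePair R (toℕ v) → PositionValue Q v
    from (x , x<m , eq , r) with fromℕ< x<m | toℕ-fromℕ< x<m
    ... | f | refl = Fin.suc f , s≤s z≤n , toℕ-injective (trans (toℕ-lookup-Φ w w-perm (Fin.suc f)) eq) ,
      Equivalence.from (Q⇔R f _) (subst (R (toℕ f)) (sym (toℕ-lookup-Φ w w-perm (Fin.suc f))) r)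

  pairValues≡positionValues : ∀ {R R′ Q} (R? : ∀ a b → Dec (R a b)) (Q? : ∀ j u → Dec (Q j u)) →
    (∀ x u → Q (Fin.suc x) u ⇔ R′ (toℕ x) (toℕ u)) → (∀ {v} → AscentPair R v ⇔ CyclePair R′ v) →
    tabulate (does ∘ pairValue? R?) ≡ tabulate (does ∘ positionValue? Q?)
  pairValues≡positionValues {R} {R′} {Q} R? Q? Q⇔R′ ascent⇔cycle = tabulate-cong λ v → does-⇔
    (⇔-sym (positionValue⇔cyclePair {Q} {R′} Q⇔R′ v) ⇔-∘ (ascent⇔cycle ⇔-∘ pairValue⇔ascentPair {R} v))
    (pairValue? R? v) (positionValue? Q? v)

  bAsc≡Exc^ : bAsc w ≡ Exc^ (Φ w)
  bAsc≡Exc^ = pairValues≡positionValues {R′ = λ a b → a + 2 ≤ b}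
    (λ a b → a + 2 ℕ.≤? b) (λ j u → toℕ j ℕ.<? toℕ u)
    (λ x u → mk⇔ (subst (_≤ toℕ u) (+-comm 2 (toℕ x))) (subst (_≤ toℕ u) (+-comm (toℕ x) 2)))
    (ascentPair⇔cyclePair (λ a+2≤b → Equivalence.from <⇔bigAscent⊎succession (inj₁ a+2≤b)))

  Des≡Drop : Des w ≡ Drop (Φ w)
  Des≡Drop = pairValues≡positionValues {R′ = λ a b → b < suc a} (λ a b → b ℕ.<? a) (λ j u → toℕ u ℕ.<? toℕ j)
    (λ _ _ → ⇔-id _) descent⇔cycleDrop

  Suc≡Fix^ : Suc w ≡ Fix^ (Φ w)
  Suc≡Fix^ = pairValues≡positionValues {R′ = λ a b → b ≡ suc a} (λ a b → b ℕ.≟ suc a) (λ j u → u FinP.≟ j)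
    (λ _ _ → mk⇔ (cong toℕ) toℕ-injective) (ascentPair⇔cyclePair (λ b≡a+1 → ≤-reflexive (sym b≡a+1)))

  asc≡basc+suc : asc w ≡ basc w + suc' w
  asc≡basc+suc = begin
    asc w
      ≡⟨ cong ∣_∣ (tabulate-cong λ i →
           does-⇔ <⇔bigAscent⊎succession (p i ℕ.<? q i) (bigAscent? i ⊎-dec succession? i)) ⟩
    ∣ tabulate (λ i → does (bigAscent? i) ∨ does (succession? i)) ∣
      ≡⟨ ∣tabulate-∨∣ _ _ (λ i → does-∧-false (bigAscent? i) (succession? i)
           λ a+2≤b b≡a+1 → <-irrefl (sym b≡a+1) (subst (_≤ q i) (+-comm (p i) 2) a+2≤b)) ⟩
    ∣ tabulate (does ∘ bigAscent?) ∣ + ∣ tabulate (does ∘ succession?) ∣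
      ≡⟨ cong₂ _+_ (∣image∣ q-injective bigAscent?) (∣image∣ q-injective succession?) ⟨
    basc w + suc' w
      ∎
    where
    open ≡-Reasoning
    p q : Fin m → ℕ
    p i = toℕ (lookup w (inject₁ i))
    q i = toℕ (lookup w (Fin.suc i))
    bigAscent? : ∀ i → Dec (p i + 2 ≤ q i)
    bigAscent? i = p i + 2 ℕ.≤? q i
    succession? : ∀ i → Dec (q i ≡ suc (p i))
    succession? i = q i ℕ.≟ suc (p i)
    q-injective : Injective _≡_ _≡_ (lookup w ∘ Fin.suc)
    q-injective eq = FinP.suc-injective (w-perm _ _ eq)

bAscDesSuc ExcDropFix : ∀ {m} → Vec (Fin (suc m)) (suc m) → Subset (suc m) × Subset (suc m) × Subset (suc m)
bAscDesSuc π = bAsc π , Des π , Suc π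
ExcDropFix π = Exc^ π , Drop π , Fix^ π

sizes : ∀ {n} → Subset n × Subset n × Subset n → ℕ × ℕ × ℕ
sizes (X , Y , Z) = ∣ X ∣ , ∣ Y ∣ , ∣ Z ∣

ExcDropFix-Φ : ∀ {m} (w : Vec (Fin (suc m)) (suc m)) → IsPerm w → ExcDropFix (Φ w) ≡ bAscDesSuc w
ExcDropFix-Φ w w-perm = sym (cong₂ _,_ bAsc≡Exc^ (cong₂ _,_ Des≡Drop Suc≡Fix^))
  where open Statistics w w-perm

exc^+fix^-Φ : ∀ {m} (w : Vec (Fin (suc m)) (suc m)) → IsPerm w → exc^ (Φ w) + fix^ (Φ w) ≡ asc w
exc^+fix^-Φ w w-perm =
  trans (sym (cong₂ _+_ (cong ∣_∣ bAsc≡Exc^) (cong ∣_∣ Suc≡Fix^))) (sym asc≡basc+suc)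
  where open Statistics w w-perm

theorem3p4 : (m : ℕ) →
    ((X Y Z : Subset (suc m)) →
      count (suc m) (λ π → (bAsc π , Des π , Suc π) ≟T (X , Y , Z))
        ≡ count (suc m) (λ π → (Exc^ π , Drop π , Fix^ π) ≟T (X , Y , Z)))
    × ((a b c : ℕ) →
      count (suc m) (λ π → (basc π ℕ.≟ a) ×-dec ((des π ℕ.≟ b) ×-dec (suc' π ℕ.≟ c)))
        ≡ count (suc m) (λ π → (exc^ π ℕ.≟ a) ×-dec ((drop π ℕ.≟ b) ×-dec (fix^ π ℕ.≟ c))))
    × ((k : ℕ) →
      count (suc m) (λ π → exc^ π + fix^ π ℕ.≟ k)
        ≡ count (suc m) (λ π → asc π ℕ.≟ k))
theorem3p4 m =
    (λ X Y Z → transport bAscDesSuc ExcDropFix ExcDropFix-Φ (_≟T (X , Y , Z)))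
  , (λ a b c → transport (sizes ∘ bAscDesSuc) (sizes ∘ ExcDropFix) (λ w → cong sizes ∘ ExcDropFix-Φ w)
       (λ t → (proj₁ t ℕ.≟ a) ×-dec ((proj₁ (proj₂ t) ℕ.≟ b) ×-dec (proj₂ (proj₂ t) ℕ.≟ c))))
  , (λ k → sym (transport asc (λ π → exc^ π + fix^ π) exc^+fix^-Φ (ℕ._≟ k)))
  where open Transport Φ Φ-isPerm Φ-injective renaming (count-transport to transport)
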